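{- Let $p>q\geq 1$ be integers and let $u_\beta$ be the fixed point of the substitution $\varphi: A\mapsto A^pB,\ B\mapsto A^qB$ (i.e. $u_\beta=\lim_{n\to\infty}\varphi^n(A)$). Then $u_\beta$ is $c$-balanced with $c=\left\lceil\frac{p-1}{q}\right\rceil$, and this value of $c$ is the smallest possible: $u_\beta$ is not $c'$-balanced for any $c'<\left\lceil\frac{p-1}{q}\right\rceil$.
   Context: An infinite word $u$ over the alphabet $\{A,B\}$ is $c$-balanced if for every pair of finite factors $w,\hat w$ of $u$ with $|w|=|\hat w|$ one has $\bigl||w|_A-|\hat w|_A\bigr|\le c$, where $|w|_A$ denotes the number of occurrences of $A$ in $w$. A morphism $\varphi$ of the free monoid $\{A,B\}^*$ is extended to infinite words letterwise. ($u_\beta$ codes the sequence of gaps between consecutive nonnegative $\beta$-integers for $\beta$ the larger root of $x^2-(p+1)x+(p-q)$.) -}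

module Defs where

open import Data.Nat using (ℕ; zero; suc; _+_; _*_; _∸_; _/_; ∣_-_∣; _≤_)
open import Data.List using (List; []; _∷_; _++_; concatMap; replicate)

data Letter : Set where
  A B : Letter

Word : Set
Word = ℕ → Letter

img : ℕ → ℕ → Letter → List Letter
img p q A = replicate p A ++ (B ∷ [])
img p q B = replicate q A ++ (B ∷ [])

φ : ℕ → ℕ → List Letter → List Letter
φ p q = concatMap (img p q)

φ^ : ℕ → ℕ → ℕ → List Letter → List Letter
φ^ p q zero    w = w
φ^ p q (suc n) w = φ p q (φ^ p q n w)

-- i-th letter of a finite word (B if out of range; never used out of range below)
at : List Letter → ℕ → Letter
at []       _       = B
at (x ∷ _)  zero    = x
at (_ ∷ xs) (suc i) = at xs i

-- u_β = lim φ^n(A): its i-th letter is the i-th letter of φ^(i+1)(A),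
-- which has length ≥ i+1 and is a prefix of all later iterates (as p ≥ 1).
uβ : ℕ → ℕ → Word
uβ p q i = at (φ^ p q (suc i) (A ∷ [])) i

isA : Letter → ℕ
isA A = 1
isA B = 0

countA : Word → ℕ → ℕ → ℕ
countA u i zero    = 0
countA u i (suc n) = isA (u i) + countA u (suc i) n

Balanced : Word → ℕ → Set
Balanced u c = ∀ (i j n : ℕ) → ∣ countA u i n - countA u j n ∣ ≤ c

-- ⌈ a / b ⌉ for b ≥ 1 (value at b = 0 is an irrelevant convention)
ceilDiv : ℕ → ℕ → ℕ
ceilDiv a zero    = 0
ceilDiv a (suc b) = (a + b) / suc b

-- Write p = q + g. Since u = φ(u), the word u is the concatenation of the blocks
-- φ(u b) = A^(ℓ (u b)) B with ℓ A = p and ℓ B = q; block b starts at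
-- T b = b (q + 1) + g |u₀ ⋯ u_(b-1)|_A, and the number of B's before a position is the
-- index of its block, so every count of A's is a difference of positions and block indices.
--
-- Upper bound, by induction on the lengths: if a factor of length m had more than c − j
-- more A's than a factor of length m + j (j < c), the blocks meeting these factors would
-- be shorter factors of u of lengths k + 1 and at least k + c, and the bound for them
-- (with j = c − 1) together with the lengths of their images forces (c − 1) q + 2 ≤ g,
-- i.e. p − 1 > c q, contradicting c = ⌈(p − 1)/q⌉.
--
-- Lower bound: applying φ to a factor of length m and a factor of length m + j with at
-- least v fewer A's produces factors whose lengths differ by any k ≤ j + 1 and whose
-- counts differ by at least j + 2 − k, provided j (q + 1) + 2 ≤ g v + k. Starting from
-- A and B this reaches two factors of equal length whose counts differ by c.

module Submission where

open import Defs
open import Data.Nat using (ℕ; _≤_; _<_; _∸_)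
open import Data.Product using (_×_)
open import Relation.Nullary using (¬_)

open import Data.Nat using (zero; suc; _+_; _*_; ∣_-_∣; z≤n; s≤s; s≤s⁻¹; z<s; _≤?_; _<?_)
open import Data.Nat.Properties
open import Data.Nat.DivMod using (_%_; m≡m%n+[m/n]*n; m%n<n)
open import Data.Nat.Induction using (<-rec)
open import Data.Nat.Tactic.RingSolver using (solve)
open import Algebra.Properties.CommutativeSemigroup +-commutativeSemigroup using (xy∙z≈xz∙y)
open import Data.List using (List; []; _∷_; _++_; length; replicate)
open import Data.List.Properties using (length-++; length-replicate; concatMap-++)
open import Data.Product using (∃-syntax; _,_; proj₁; proj₂)
open import Relation.Nullary using (yes; no; contradiction)
open import Relation.Binary.PropositionalEquality

∣m-n∣≤o : ∀ {m n o} → m ≤ n + o → n ≤ m + o → ∣ m - n ∣ ≤ o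
∣m-n∣≤o {zero}  {n}     _         n≤o       = n≤o
∣m-n∣≤o {suc m} {zero}  m≤o       _         = m≤o
∣m-n∣≤o {suc m} {suc n} (s≤s m≤n) (s≤s n≤m) = ∣m-n∣≤o m≤n n≤m

at-++ˡ : ∀ (xs ys : List Letter) {i} → i < length xs → at (xs ++ ys) i ≡ at xs i
at-++ˡ (x ∷ xs) ys {zero}  _         = refl
at-++ˡ (x ∷ xs) ys {suc i} (s≤s i<n) = at-++ˡ xs ys i<n

at-++ʳ : ∀ (xs ys : List Letter) i → at (xs ++ ys) (length xs + i) ≡ at ys i
at-++ʳ []       ys i = refl
at-++ʳ (x ∷ xs) ys i = at-++ʳ xs ys i

at-replicate : ∀ n ys {r} → r < n → at (replicate n A ++ ys) r ≡ A
at-replicate (suc n) ys {zero}  _         = refl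
at-replicate (suc n) ys {suc r} (s≤s r<n) = at-replicate n ys r<n

at-replicate-end : ∀ n ys → at (replicate n A ++ ys) n ≡ at ys 0
at-replicate-end zero    ys = refl
at-replicate-end (suc n) ys = at-replicate-end n ys

countA-+ : ∀ (u : Word) i m n → countA u i (m + n) ≡ countA u i m + countA u (i + m) n
countA-+ u i zero    n = cong (λ j → countA u j n) (sym (+-identityʳ i))
countA-+ u i (suc m) n = begin
  isA (u i) + countA u (suc i) (m + n)
    ≡⟨ cong (isA (u i) +_) (countA-+ u (suc i) m n) ⟩
  isA (u i) + (countA u (suc i) m + countA u (suc i + m) n)
    ≡⟨ sym (+-assoc (isA (u i)) _ _) ⟩
  countA u i (suc m) + countA u (suc i + m) n
    ≡⟨ cong (λ j → countA u i (suc m) + countA u j n) (sym (+-suc i m)) ⟩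
  countA u i (suc m) + countA u (i + suc m) n ∎
  where open ≡-Reasoning

countA-mono : ∀ (u : Word) i {m n} → m ≤ n → countA u i m ≤ countA u i n
countA-mono u i {m} m≤n with o , refl ← m≤n⇒∃[o]m+o≡n m≤n = begin
  countA u i m                        ≤⟨ m≤m+n _ _ ⟩
  countA u i m + countA u (i + m) o   ≡⟨ sym (countA-+ u i m o) ⟩
  countA u i (m + o)                  ∎
  where open ≤-Reasoning

countA-all-A : ∀ (u : Word) i n → (∀ {r} → r < n → u (i + r) ≡ A) → countA u i n ≡ n
countA-all-A u i zero    _    = refl
countA-all-A u i (suc n) allA = cong₂ _+_
  (cong isA (trans (cong u (sym (+-identityʳ i))) (allA z<s)))
  (countA-all-A u (suc i) n (λ r<n → trans (cong u (sym (+-suc i _))) (allA (s≤s r<n))))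

-- Positions in images under φ

module Desubstitution (p q : ℕ) where

  ℓ : Letter → ℕ
  ℓ A = p
  ℓ B = q

  img-shape : ∀ x → img p q x ≡ replicate (ℓ x) A ++ B ∷ []
  img-shape A = refl
  img-shape B = refl

  length-img : ∀ x → length (img p q x) ≡ suc (ℓ x)
  length-img x rewrite img-shape x = begin
    length (replicate (ℓ x) A ++ B ∷ [])  ≡⟨ length-++ (replicate (ℓ x) A) ⟩
    length (replicate (ℓ x) A) + 1        ≡⟨ cong (_+ 1) (length-replicate (ℓ x)) ⟩
    ℓ x + 1                               ≡⟨ +-comm (ℓ x) 1 ⟩
    suc (ℓ x)                             ∎
    where open ≡-Reasoning

  img-A : ∀ x {r} → r < ℓ x → at (img p q x) r ≡ A
  img-A x r<ℓ rewrite img-shape x = at-replicate (ℓ x) _ r<ℓ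

  img-B : ∀ x → at (img p q x) (ℓ x) ≡ B
  img-B x rewrite img-shape x = at-replicate-end (ℓ x) _

  blockStart : (ℕ → Letter) → ℕ → ℕ
  blockStart f zero    = 0
  blockStart f (suc b) = length (img p q (f 0)) + blockStart (λ i → f (suc i)) b

  blockStart-suc : ∀ f b → blockStart f (suc b) ≡ blockStart f b + length (img p q (f b))
  blockStart-suc f zero    = +-identityʳ _
  blockStart-suc f (suc b) = begin
    length (img p q (f 0)) + blockStart (λ i → f (suc i)) (suc b)
      ≡⟨ cong (length (img p q (f 0)) +_) (blockStart-suc (λ i → f (suc i)) b) ⟩
    length (img p q (f 0)) + (blockStart (λ i → f (suc i)) b + length (img p q (f (suc b))))
      ≡⟨ sym (+-assoc (length (img p q (f 0))) _ _) ⟩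
    blockStart f (suc b) + length (img p q (f (suc b))) ∎
    where open ≡-Reasoning

  blockStart-cong : ∀ {f f′} b → (∀ {i} → i < b → f i ≡ f′ i) →
                    blockStart f b ≡ blockStart f′ b
  blockStart-cong zero    _  = refl
  blockStart-cong (suc b) f≗ = cong₂ _+_
    (cong (λ x → length (img p q x)) (f≗ z<s))
    (blockStart-cong b (λ i<b → f≗ (s≤s i<b)))

  at-φ : ∀ xs {b r} → b < length xs → r < length (img p q (at xs b)) →
         at (φ p q xs) (blockStart (at xs) b + r) ≡ at (img p q (at xs b)) r
  at-φ (x ∷ xs) {zero}      _         r< = at-++ˡ (img p q x) (φ p q xs) r<
  at-φ (x ∷ xs) {suc b} {r} (s≤s b<n) r< = begin
    at (img p q x ++ φ p q xs) (length (img p q x) + blockStart (at xs) b + r)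
      ≡⟨ cong (at (img p q x ++ φ p q xs)) (+-assoc (length (img p q x)) _ r) ⟩
    at (img p q x ++ φ p q xs) (length (img p q x) + (blockStart (at xs) b + r))
      ≡⟨ at-++ʳ (img p q x) (φ p q xs) _ ⟩
    at (φ p q xs) (blockStart (at xs) b + r)
      ≡⟨ at-φ xs b<n r< ⟩
    at (img p q (at xs b)) r ∎
    where open ≡-Reasoning

-- The fixed point as a sequence of blocks

module FixedPoint (q g : ℕ) (1≤q : 1 ≤ q) where

  p : ℕ
  p = q + g

  open Desubstitution p q

  u : Word
  u = uβ p q

  w : ℕ → List Letter
  w n = φ^ p q n (A ∷ [])

  1≤ℓ : ∀ x → 1 ≤ ℓ x
  1≤ℓ A = ≤-trans 1≤q (m≤m+n q g)
  1≤ℓ B = 1≤q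

  img-A-head : ∃[ s ] img p q A ≡ A ∷ s
  img-A-head with _ , 1+p′≡p ← m≤n⇒∃[o]m+o≡n (1≤ℓ A) =
    subst (λ n → ∃[ s ] replicate n A ++ B ∷ [] ≡ A ∷ s) 1+p′≡p (_ , refl)

  w-head : ∀ n → ∃[ s ] w n ≡ A ∷ s
  w-head zero    = [] , refl
  w-head (suc n) with s , w≡ ← w-head n | s′ , img≡ ← img-A-head = s′ ++ φ p q s , (begin
    φ p q (w n)                ≡⟨ cong (φ p q) w≡ ⟩
    img p q A ++ φ p q s       ≡⟨ cong (_++ φ p q s) img≡ ⟩
    A ∷ s′ ++ φ p q s          ∎)
    where open ≡-Reasoning

  w-prefix : ∀ n k → ∃[ t ] w (n + k) ≡ w n ++ t
  w-prefix zero    k = w-head k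
  w-prefix (suc n) k with t , w≡ ← w-prefix n k = φ p q t , (begin
    φ p q (w (n + k))          ≡⟨ cong (φ p q) w≡ ⟩
    φ p q (w n ++ t)           ≡⟨ concatMap-++ (img p q) (w n) t ⟩
    φ p q (w n) ++ φ p q t     ∎)
    where open ≡-Reasoning

  length-φ : ∀ xs → length xs + length xs ≤ length (φ p q xs)
  length-φ []       = z≤n
  length-φ (x ∷ xs) = begin
    suc (length xs) + suc (length xs)        ≡⟨ cong suc (+-suc (length xs) (length xs)) ⟩
    2 + (length xs + length xs)              ≤⟨ +-mono-≤ (s≤s (1≤ℓ x)) (length-φ xs) ⟩
    suc (ℓ x) + length (φ p q xs)            ≡⟨ cong (_+ length (φ p q xs)) (sym (length-img x)) ⟩
    length (img p q x) + length (φ p q xs)   ≡⟨ sym (length-++ (img p q x)) ⟩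
    length (img p q x ++ φ p q xs)           ∎
    where open ≤-Reasoning

  length-w : ∀ n → n < length (w n)
  length-w zero    = z<s
  length-w (suc n) = begin-strict
    suc n                          <⟨ s≤s (m≤n+m (suc n) n) ⟩
    suc n + suc n                  ≤⟨ +-mono-≤ (length-w n) (length-w n) ⟩
    length (w n) + length (w n)    ≤⟨ length-φ (w n) ⟩
    length (w (suc n))             ∎
    where open ≤-Reasoning

  at-w-+ : ∀ n k {i} → i < length (w n) → at (w (n + k)) i ≡ at (w n) i
  at-w-+ n k i< with t , w≡ ← w-prefix n k =
    trans (cong (λ v → at v _) w≡) (at-++ˡ (w n) t i<)

  u≡at-w : ∀ {i} n → i < length (w n) → u i ≡ at (w n) i
  u≡at-w {i} n i< = begin
    at (w (suc i)) i         ≡⟨ sym (at-w-+ (suc i) n (<-trans (n<1+n i) (length-w (suc i)))) ⟩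
    at (w (suc i + n)) i     ≡⟨ cong (λ k → at (w k) i) (+-comm (suc i) n) ⟩
    at (w (n + suc i)) i     ≡⟨ at-w-+ n (suc i) i< ⟩
    at (w n) i               ∎
    where open ≡-Reasoning

  T : ℕ → ℕ
  T = blockStart u

  T-suc : ∀ b → T (suc b) ≡ T b + suc (ℓ (u b))
  T-suc b = trans (blockStart-suc u b) (cong (T b +_) (length-img (u b)))

  -- u = φ(u): read u at T b + r inside w (N + 1) = φ(w N) for N large.
  u-T : ∀ b {r} → r ≤ ℓ (u b) → u (T b + r) ≡ at (img p q (u b)) r
  u-T b {r} r≤ℓ = begin
    u (T b + r)
      ≡⟨ u≡at-w (suc N) Tb+r<∣wN+1∣ ⟩
    at (φ p q (w N)) (T b + r)
      ≡⟨ cong (λ t → at (φ p q (w N)) (t + r)) T≡ ⟩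
    at (φ p q (w N)) (blockStart (at (w N)) b + r)
      ≡⟨ at-φ (w N) b<∣wN∣ r< ⟩
    at (img p q (at (w N) b)) r
      ≡⟨ cong (λ x → at (img p q x) r) (sym (u≡at-w N b<∣wN∣)) ⟩
    at (img p q (u b)) r ∎
    where
    open ≡-Reasoning
    N : ℕ
    N = b + (T b + r)
    b<∣wN∣ : b < length (w N)
    b<∣wN∣ = ≤-<-trans (m≤m+n b _) (length-w N)
    Tb+r<∣wN+1∣ : T b + r < length (w (suc N))
    Tb+r<∣wN+1∣ = ≤-<-trans (≤-trans (m≤n+m _ b) (n≤1+n N)) (length-w (suc N))
    T≡ : T b ≡ blockStart (at (w N)) b
    T≡ = blockStart-cong b (λ i<b → u≡at-w N (<-trans i<b b<∣wN∣))
    r< : r < length (img p q (at (w N) b))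
    r< = subst (λ x → r < length (img p q x)) (u≡at-w N b<∣wN∣)
           (≤-trans (s≤s r≤ℓ) (≤-reflexive (sym (length-img (u b)))))

  u-T-A : ∀ b {r} → r < ℓ (u b) → u (T b + r) ≡ A
  u-T-A b r<ℓ = trans (u-T b (<⇒≤ r<ℓ)) (img-A (u b) r<ℓ)

  u-T-B : ∀ b → u (T b + ℓ (u b)) ≡ B
  u-T-B b = trans (u-T b ≤-refl) (img-B (u b))

  suc-ℓ : ∀ x → suc (ℓ x) ≡ suc q + g * isA x
  suc-ℓ A = cong (λ n → suc (q + n)) (sym (*-identityʳ g))
  suc-ℓ B = cong suc (sym (trans (cong (q +_) (*-zeroʳ g)) (+-identityʳ q)))

  T-+ : ∀ b n → T (b + n) ≡ T b + (n * suc q + g * countA u b n)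
  T-+ b zero    = trans (cong T (+-identityʳ b))
                    (sym (trans (cong (T b +_) (*-zeroʳ g)) (+-identityʳ (T b))))
  T-+ b (suc n) = begin
    T (b + suc n)                                 ≡⟨ cong T (+-suc b n) ⟩
    T (suc b + n)                                 ≡⟨ T-+ (suc b) n ⟩
    T (suc b) + rest                              ≡⟨ cong (_+ rest) (T-suc b) ⟩
    T b + suc (ℓ (u b)) + rest                    ≡⟨ cong (λ l → T b + l + rest) (suc-ℓ (u b)) ⟩
    T b + (suc q + g * isA (u b)) + rest          ≡⟨ regroup (T b) (isA (u b)) (countA u (suc b) n) n ⟩
    T b + (suc n * suc q + g * countA u b (suc n)) ∎
    where
    open ≡-Reasoning
    rest : ℕ
    rest = n * suc q + g * countA u (suc b) n
    regroup : ∀ t a c n → t + (suc q + g * a) + (n * suc q + g * c) ≡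
                          t + (suc n * suc q + g * (a + c))
    regroup t a c n = solve (t ∷ a ∷ c ∷ n ∷ q ∷ g ∷ [])

  T-mono-≤ : ∀ {b b′} → b ≤ b′ → T b ≤ T b′
  T-mono-≤ {b} b≤b′ with n , refl ← m≤n⇒∃[o]m+o≡n b≤b′ =
    ≤-trans (m≤m+n (T b) _) (≤-reflexive (sym (T-+ b n)))

  T-< : ∀ {b b′} → b < b′ → T b < T b′
  T-< {b} b<b′ with n , refl ← m≤n⇒∃[o]m+o≡n b<b′ = begin-strict
    T b                                               <⟨ m<m+n (T b) z<s ⟩
    T b + (suc n * suc q + g * countA u b (suc n))    ≡⟨ sym (T-+ b (suc n)) ⟩
    T (b + suc n)                                     ≡⟨ cong T (+-suc b n) ⟩
    T (suc b + n)                                     ∎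
    where open ≤-Reasoning

  T-cancel-< : ∀ {b b′} → T b < T b′ → b < b′
  T-cancel-< {b} {b′} Tb<Tb′ with b <? b′
  ... | yes b<b′ = b<b′
  ... | no  b≮b′ = contradiction (T-mono-≤ (≮⇒≥ b≮b′)) (<⇒≱ Tb<Tb′)

  record InBlock (b i : ℕ) : Set where
    constructor inBlock
    field
      lower : T b ≤ i
      upper : i < T (suc b)
  open InBlock

  InBlock-T : ∀ b → InBlock b (T b)
  InBlock-T b = inBlock ≤-refl (T-< (n<1+n b))

  InBlock-≤ : ∀ {b b′ i i′} → InBlock b i → InBlock b′ i′ → i ≤ i′ → b ≤ b′
  InBlock-≤ (inBlock Tb≤i _) (inBlock _ i′<Tb′+1) i≤i′ =
    s≤s⁻¹ (T-cancel-< (≤-<-trans (≤-trans Tb≤i i≤i′) i′<Tb′+1))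

  block : ∀ i → ∃[ b ] InBlock b i
  block zero = 0 , inBlock z≤n (T-< {0} {1} z<s)
  block (suc i) with b , inBlock Tb≤i i<Tb+1 ← block i | suc i <? T (suc b)
  ... | yes i+1<Tb+1 = b , inBlock (m≤n⇒m≤1+n Tb≤i) i+1<Tb+1
  ... | no  i+1≮Tb+1 = suc b , inBlock (≮⇒≥ i+1≮Tb+1) (≤-<-trans i<Tb+1 (T-< (n<1+n (suc b))))

  countA-in-block : ∀ b {r} → r ≤ ℓ (u b) → countA u (T b) r ≡ r
  countA-in-block b r≤ℓ = countA-all-A u (T b) _ (λ r′<r → u-T-A b (<-≤-trans r′<r r≤ℓ))

  countA-block : ∀ b → countA u (T b) (suc (ℓ (u b))) ≡ ℓ (u b)
  countA-block b = begin
    countA u (T b) (suc (ℓ (u b)))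
      ≡⟨ cong (countA u (T b)) (+-comm 1 (ℓ (u b))) ⟩
    countA u (T b) (ℓ (u b) + 1)
      ≡⟨ countA-+ u (T b) (ℓ (u b)) 1 ⟩
    countA u (T b) (ℓ (u b)) + countA u (T b + ℓ (u b)) 1
      ≡⟨ cong₂ _+_ (countA-in-block b ≤-refl) (cong (λ x → isA x + 0) (u-T-B b)) ⟩
    ℓ (u b) + 0
      ≡⟨ +-identityʳ _ ⟩
    ℓ (u b) ∎
    where open ≡-Reasoning

  countA-T : ∀ b → countA u 0 (T b) + b ≡ T b
  countA-T zero    = refl
  countA-T (suc b) = begin
    countA u 0 (T (suc b)) + suc b
      ≡⟨ cong (λ t → countA u 0 t + suc b) (T-suc b) ⟩
    countA u 0 (T b + suc (ℓ (u b))) + suc b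
      ≡⟨ cong (_+ suc b) (countA-+ u 0 (T b) _) ⟩
    countA u 0 (T b) + countA u (T b) (suc (ℓ (u b))) + suc b
      ≡⟨ cong (λ a → countA u 0 (T b) + a + suc b) (countA-block b) ⟩
    countA u 0 (T b) + ℓ (u b) + suc b
      ≡⟨ swap (countA u 0 (T b)) (ℓ (u b)) b ⟩
    countA u 0 (T b) + b + suc (ℓ (u b))
      ≡⟨ cong (_+ suc (ℓ (u b))) (countA-T b) ⟩
    T b + suc (ℓ (u b))
      ≡⟨ sym (T-suc b) ⟩
    T (suc b) ∎
    where
    open ≡-Reasoning
    swap : ∀ a l b → a + l + suc b ≡ a + b + suc l
    swap a l b = solve (a ∷ l ∷ b ∷ [])

  countA-InBlock : ∀ {b i} → InBlock b i → countA u 0 i + b ≡ i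
  countA-InBlock {b} (inBlock Tb≤i i<Tb+1) with r , refl ← m≤n⇒∃[o]m+o≡n Tb≤i = begin
    countA u 0 (T b + r) + b
      ≡⟨ cong (_+ b) (countA-+ u 0 (T b) r) ⟩
    countA u 0 (T b) + countA u (T b) r + b
      ≡⟨ cong (λ a → countA u 0 (T b) + a + b) (countA-in-block b r≤ℓ) ⟩
    countA u 0 (T b) + r + b
      ≡⟨ xy∙z≈xz∙y (countA u 0 (T b)) r b ⟩
    countA u 0 (T b) + b + r
      ≡⟨ cong (_+ r) (countA-T b) ⟩
    T b + r ∎
    where
    open ≡-Reasoning
    r≤ℓ : r ≤ ℓ (u b)
    r≤ℓ = s≤s⁻¹ (+-cancelˡ-≤ (T b) _ _ (≤-trans (≤-reflexive (+-suc (T b) r))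
                                         (≤-trans i<Tb+1 (≤-reflexive (T-suc b)))))

  countA-window : ∀ {b b′ x m} → InBlock b x → InBlock b′ (x + m) → countA u x m + b′ ≡ m + b
  countA-window {b} {b′} {x} {m} x∈b x+m∈b′ = +-cancelˡ-≡ (countA u 0 x + b) _ _ (begin
    countA u 0 x + b + (countA u x m + b′)
      ≡⟨ regroup (countA u 0 x) b (countA u x m) b′ ⟩
    countA u 0 x + countA u x m + b′ + b
      ≡⟨ cong (λ a → a + b′ + b) (sym (countA-+ u 0 x m)) ⟩
    countA u 0 (x + m) + b′ + b
      ≡⟨ cong (_+ b) (countA-InBlock x+m∈b′) ⟩
    x + m + b
      ≡⟨ +-assoc x m b ⟩
    x + (m + b)
      ≡⟨ cong (_+ (m + b)) (sym (countA-InBlock x∈b)) ⟩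
    countA u 0 x + b + (m + b) ∎)
    where
    open ≡-Reasoning
    regroup : ∀ f b a b′ → f + b + (a + b′) ≡ f + a + b′ + b
    regroup f b a b′ = solve (f ∷ b ∷ a ∷ b′ ∷ [])

  -- Upper bound

  module UpperBound (c₁ : ℕ) (g≤c₁q+1 : g ≤ c₁ * q + 1) where

    blocks-spread : ∀ a₁ a₂ m j b k d d′ → a₁ + (b + k) ≡ m + b →
                    a₂ + d′ ≡ (m + j) + d → a₂ + suc c₁ < a₁ + j → suc d + (suc k + c₁) ≤ d′
    blocks-spread a₁ a₂ m j b k d d′ e₁ e₂ excess =
      +-cancelˡ-≤ a₂ _ _ (+-cancelʳ-≤ b _ _ (begin
        a₂ + (suc d + (suc k + c₁)) + b   ≡⟨ solve (a₂ ∷ d ∷ k ∷ c₁ ∷ b ∷ []) ⟩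
        suc (a₂ + suc c₁) + (b + k + d)   ≤⟨ +-monoˡ-≤ (b + k + d) excess ⟩
        a₁ + j + (b + k + d)              ≡⟨ solve (a₁ ∷ j ∷ b ∷ k ∷ d ∷ []) ⟩
        a₁ + (b + k) + j + d              ≡⟨ cong (λ n → n + j + d) e₁ ⟩
        m + b + j + d                     ≡⟨ solve (m ∷ b ∷ j ∷ d ∷ []) ⟩
        m + j + d + b                     ≡⟨ cong (_+ b) (sym e₂) ⟩
        a₂ + d′ + b                       ∎))
      where open ≤-Reasoning

    spread-< : ∀ a₂ m j d n d′ → suc d + n ≤ d′ → a₂ + d′ ≡ (m + j) + d → n < m + j
    spread-< a₂ m j d n d′ d+1+n≤d′ e₂ = +-cancelˡ-≤ d _ _ (begin
      d + suc n       ≡⟨ +-suc d n ⟩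
      suc d + n       ≤⟨ d+1+n≤d′ ⟩
      d′              ≤⟨ m≤n+m d′ a₂ ⟩
      a₂ + d′         ≡⟨ e₂ ⟩
      m + j + d       ≡⟨ +-comm (m + j) d ⟩
      d + (m + j)     ∎)
      where open ≤-Reasoning

    lengths-from-positions : ∀ {t x y t′} m j L₁ L₂ → t ≤ x → x + m < t + L₁ →
                             y < t′ → t′ + L₂ ≤ y + (m + j) → L₂ + 2 ≤ L₁ + j
    lengths-from-positions {t} {x} {y} {t′} m j L₁ L₂ t≤x x+m<t+L₁ y<t′ t′+L₂≤ = begin
      L₂ + 2         ≡⟨ +-comm L₂ 2 ⟩
      suc (suc L₂)   ≤⟨ s≤s L₂<m+j ⟩
      suc (m + j)    ≤⟨ +-monoˡ-≤ j m<L₁ ⟩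
      L₁ + j         ∎
      where
      open ≤-Reasoning
      L₂<m+j : L₂ < m + j
      L₂<m+j = +-cancelˡ-≤ y _ _ (begin
        y + suc L₂     ≡⟨ +-suc y L₂ ⟩
        suc y + L₂     ≤⟨ +-monoˡ-≤ L₂ y<t′ ⟩
        t′ + L₂        ≤⟨ t′+L₂≤ ⟩
        y + (m + j)    ∎)
      m<L₁ : m < L₁
      m<L₁ = +-cancelˡ-≤ x _ _ (begin
        x + suc m      ≡⟨ +-suc x m ⟩
        suc (x + m)    ≤⟨ x+m<t+L₁ ⟩
        t + L₁         ≤⟨ +-monoˡ-≤ L₁ t≤x ⟩
        x + L₁         ∎)

    short-window : ∀ n e a₁ a₂ j →
                   (n + c₁ + e) * suc q + g * a₂ + 2 ≤ n * suc q + g * a₁ + j →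
                   a₁ ≤ a₂ + 1 → j ≤ c₁ → c₁ * q + 1 < g
    short-window n e a₁ a₂ j L₂+2≤L₁+j a₁≤a₂+1 j≤c₁ =
      +-cancelʳ-≤ (n * suc q + g * a₂ + c₁) _ _ (begin
        suc (c₁ * q + 1) + (n * suc q + g * a₂ + c₁)
          ≡⟨ solve (c₁ ∷ q ∷ n ∷ g ∷ a₂ ∷ []) ⟩
        (n + c₁) * suc q + g * a₂ + 2
          ≤⟨ +-monoˡ-≤ 2 (+-monoˡ-≤ (g * a₂) (*-monoˡ-≤ (suc q) (m≤m+n (n + c₁) e))) ⟩
        (n + c₁ + e) * suc q + g * a₂ + 2
          ≤⟨ L₂+2≤L₁+j ⟩
        n * suc q + g * a₁ + j
          ≤⟨ +-mono-≤ (+-monoʳ-≤ (n * suc q) (*-monoʳ-≤ g a₁≤a₂+1)) j≤c₁ ⟩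
        n * suc q + g * (a₂ + 1) + c₁
          ≡⟨ solve (n ∷ q ∷ g ∷ a₂ ∷ c₁ ∷ []) ⟩
        g + (n * suc q + g * a₂ + c₁) ∎)
      where open ≤-Reasoning

    WindowBound : ℕ → Set
    WindowBound s = ∀ {m j} → m + j ≡ s → j ≤ c₁ → ∀ x y →
                    countA u x m + j ≤ countA u y (m + j) + suc c₁

    window-bound-longer : ∀ {n} → WindowBound (n + c₁) → ∀ x y e →
                          countA u x n ≤ countA u y (n + c₁ + e) + 1
    window-bound-longer {n} bound x y e = +-cancelʳ-≤ c₁ _ _ (begin
      countA u x n + c₁
        ≤⟨ bound refl ≤-refl x y ⟩
      countA u y (n + c₁) + suc c₁
        ≤⟨ +-monoˡ-≤ (suc c₁) (countA-mono u y (m≤m+n (n + c₁) e)) ⟩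
      countA u y (n + c₁ + e) + suc c₁
        ≡⟨ sym (+-assoc (countA u y (n + c₁ + e)) 1 c₁) ⟩
      countA u y (n + c₁ + e) + 1 + c₁ ∎)
      where open ≤-Reasoning

    -- Blocks b, …, b + k meet the factor at x and blocks d + 1, …, d′ − 1 lie inside the
    -- factor at y; the induction hypothesis compares these two factors of u.
    no-excess : ∀ {m j} → (∀ {s} → s < m + j → WindowBound s) → j ≤ c₁ → ∀ x y →
                ¬ (countA u y (m + j) + suc c₁ < countA u x m + j)
    no-excess {m} {j} IH j≤c₁ x y excess
      with b , x∈b ← block x | b′ , x+m∈b′ ← block (x + m)
         | d , y∈d ← block y | d′ , y+m+j∈d′ ← block (y + (m + j))
      with k , refl ← m≤n⇒∃[o]m+o≡n (InBlock-≤ x∈b x+m∈b′ (m≤m+n x m))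
      = <⇒≱ (short-window (suc k) e A₁ A₂ j
              (lengths-from-positions m j L₁ L₂ (lower x∈b) x+m<Tb+L₁ (upper y∈d) Td+1+L₂≤)
              A₁≤A₂+1 j≤c₁)
            g≤c₁q+1
      where
      count-y≡ : countA u y (m + j) + d′ ≡ (m + j) + d
      count-y≡ = countA-window y∈d y+m+j∈d′
      spread : suc d + (suc k + c₁) ≤ d′
      spread = blocks-spread (countA u x m) (countA u y (m + j)) m j b k d d′
                 (countA-window x∈b x+m∈b′) count-y≡ excess
      e : ℕ
      e = proj₁ (m≤n⇒∃[o]m+o≡n spread)
      d′≡ : suc d + (suc k + c₁) + e ≡ d′
      d′≡ = proj₂ (m≤n⇒∃[o]m+o≡n spread)
      n₂ A₁ A₂ L₁ L₂ : ℕ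
      n₂ = suc k + c₁ + e
      A₁ = countA u b (suc k)
      A₂ = countA u (suc d) n₂
      L₁ = suc k * suc q + g * A₁
      L₂ = n₂ * suc q + g * A₂
      A₁≤A₂+1 : A₁ ≤ A₂ + 1
      A₁≤A₂+1 = window-bound-longer
                  (IH (spread-< (countA u y (m + j)) m j d (suc k + c₁) d′ spread count-y≡))
                  b (suc d) e
      x+m<Tb+L₁ : x + m < T b + L₁
      x+m<Tb+L₁ = begin-strict
        x + m              <⟨ upper x+m∈b′ ⟩
        T (suc (b + k))    ≡⟨ cong T (sym (+-suc b k)) ⟩
        T (b + suc k)      ≡⟨ T-+ b (suc k) ⟩
        T b + L₁           ∎
        where open ≤-Reasoning
      Td+1+L₂≤ : T (suc d) + L₂ ≤ y + (m + j)
      Td+1+L₂≤ = begin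
        T (suc d) + L₂                  ≡⟨ sym (T-+ (suc d) n₂) ⟩
        T (suc d + n₂)                  ≡⟨ cong T (sym (+-assoc (suc d) (suc k + c₁) e)) ⟩
        T (suc d + (suc k + c₁) + e)    ≡⟨ cong T d′≡ ⟩
        T d′                            ≤⟨ lower y+m+j∈d′ ⟩
        y + (m + j)                     ∎
        where open ≤-Reasoning

    window-bound : ∀ s → WindowBound s
    window-bound = <-rec WindowBound step
      where
      step : ∀ s → (∀ {s′} → s′ < s → WindowBound s′) → WindowBound s
      step _ IH {m} {j} refl j≤c₁ x y with countA u x m + j ≤? countA u y (m + j) + suc c₁
      ... | yes bound  = bound
      ... | no  excess = contradiction (≰⇒> excess) (no-excess IH j≤c₁ x y)

  uβ-balanced : ∀ c₁ → p ≤ suc c₁ * q + 1 → Balanced u (suc c₁)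
  uβ-balanced c₁ p≤ x y n = ∣m-n∣≤o (bound x y) (bound y x)
    where
    open UpperBound c₁ (+-cancelˡ-≤ q _ _ (≤-trans p≤ (≤-reflexive (+-assoc q (c₁ * q) 1))))
    bound : ∀ x y → countA u x n ≤ countA u y n + suc c₁
    bound x y = subst₂ _≤_ (+-identityʳ _)
                  (cong (λ n′ → countA u y n′ + suc c₁) (+-identityʳ n))
                  (window-bound (n + 0) refl z≤n x y)

  -- Lower bound

  -- y ≥ 1 so that lift can start the new longer factor at the B that ends block y − 1.
  record Unbalance (k v : ℕ) : Set where
    constructor unbalance
    field
      x y m : ℕ
      1≤y   : 1 ≤ y
      gap   : countA u y (m + k) + v ≤ countA u x m

  lift-inside : ∀ m j k n v a₁ a₂ → k + n ≡ suc ((m + j) * suc q + g * a₂) →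
                a₂ + v ≤ a₁ → j * suc q + 2 ≤ g * v + k → n < m * suc q + g * a₁
  lift-inside m j k n v a₁ a₂ k+n≡ a₂+v≤a₁ cond = +-cancelʳ-≤ k _ _ (begin
    suc n + k                                  ≡⟨ cong suc (+-comm n k) ⟩
    suc (k + n)                                ≡⟨ cong suc k+n≡ ⟩
    suc (suc ((m + j) * suc q + g * a₂))       ≡⟨ solve (m ∷ j ∷ q ∷ g ∷ a₂ ∷ []) ⟩
    m * suc q + g * a₂ + (j * suc q + 2)       ≤⟨ +-monoʳ-≤ (m * suc q + g * a₂) cond ⟩
    m * suc q + g * a₂ + (g * v + k)           ≡⟨ solve (m ∷ q ∷ g ∷ a₂ ∷ v ∷ k ∷ []) ⟩
    m * suc q + g * (a₂ + v) + k               ≤⟨ +-monoˡ-≤ k (+-monoʳ-≤ (m * suc q)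
                                                    (*-monoʳ-≤ g a₂+v≤a₁)) ⟩
    m * suc q + g * a₁ + k                     ∎)
    where open ≤-Reasoning

  lift-gap : ∀ a a′ b x y₀ m j n k v′ → a′ + (suc y₀ + (m + j)) ≡ (n + k) + y₀ →
             a + b ≡ n + x → b < x + m → v′ + k ≡ j + 2 → a′ + v′ ≤ a
  lift-gap a a′ b x y₀ m j n k v′ e₁ e₂ b<x+m e₃ =
    +-cancelʳ-≤ (suc y₀ + (m + j) + k + b) _ _ (begin
      a′ + v′ + (suc y₀ + (m + j) + k + b)
        ≡⟨ solve (a′ ∷ v′ ∷ y₀ ∷ m ∷ j ∷ k ∷ b ∷ []) ⟩
      a′ + (suc y₀ + (m + j)) + (v′ + k) + b
        ≡⟨ cong₂ (λ s t → s + t + b) e₁ e₃ ⟩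
      n + k + y₀ + (j + 2) + b
        ≡⟨ solve (n ∷ k ∷ y₀ ∷ j ∷ b ∷ []) ⟩
      n + k + y₀ + j + 1 + suc b
        ≤⟨ +-monoʳ-≤ (n + k + y₀ + j + 1) b<x+m ⟩
      n + k + y₀ + j + 1 + (x + m)
        ≡⟨ solve (n ∷ k ∷ y₀ ∷ j ∷ x ∷ m ∷ []) ⟩
      n + x + (suc y₀ + (m + j) + k)
        ≡⟨ cong (_+ (suc y₀ + (m + j) + k)) (sym e₂) ⟩
      a + b + (suc y₀ + (m + j) + k)
        ≡⟨ solve (a ∷ b ∷ y₀ ∷ m ∷ j ∷ k ∷ []) ⟩
      a + (suc y₀ + (m + j) + k + b) ∎)
    where open ≤-Reasoning

  -- The new factors are the first n letters of φ(u x ⋯ u (x+m-1)), and the B before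
  -- φ(u y ⋯ u (y+m+j-1)) followed by that image, with n chosen so that the lengths differ by k.
  lift : ∀ {j v k v′} → Unbalance j v → k ≤ suc j → j * suc q + 2 ≤ g * v + k →
         v′ + k ≡ j + 2 → Unbalance k v′
  lift {j} {v} {k} {v′} (unbalance x (suc y₀) m _ gap) k≤j+1 cond v′+k≡ =
    unbalance (T x) y′ n (≤-trans (1≤ℓ (u y₀)) (m≤n+m _ (T y₀)))
      (lift-gap (countA u (T x) n) (countA u y′ (n + k)) bs x y₀ m j n k v′
        (countA-window y′∈y₀ end∈) (countA-window (InBlock-T x) Tx+n∈bs) bs<x+m v′+k≡)
    where
    y′ A₁ A₂ L₂ : ℕ
    y′ = T y₀ + ℓ (u y₀)
    A₁ = countA u x m
    A₂ = countA u (suc y₀) (m + j)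
    L₂ = (m + j) * suc q + g * A₂
    T[y₀+1]≡ : T (suc y₀) ≡ suc y′
    T[y₀+1]≡ = trans (T-suc y₀) (+-suc (T y₀) (ℓ (u y₀)))
    k≤L₂+1 : k ≤ suc L₂
    k≤L₂+1 = ≤-trans k≤j+1
               (s≤s (≤-trans (m≤n+m j m) (≤-trans (m≤m*n (m + j) (suc q)) (m≤m+n _ _))))
    n : ℕ
    n = proj₁ (m≤n⇒∃[o]m+o≡n k≤L₂+1)
    k+n≡ : k + n ≡ suc L₂
    k+n≡ = proj₂ (m≤n⇒∃[o]m+o≡n k≤L₂+1)
    y′∈y₀ : InBlock y₀ y′
    y′∈y₀ = inBlock (m≤m+n _ _) (≤-reflexive (sym T[y₀+1]≡))
    end∈ : InBlock (suc y₀ + (m + j)) (y′ + (n + k))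
    end∈ = subst (InBlock _) (sym (begin
      y′ + (n + k)             ≡⟨ cong (y′ +_) (trans (+-comm n k) k+n≡) ⟩
      y′ + suc L₂              ≡⟨ +-suc y′ L₂ ⟩
      suc y′ + L₂              ≡⟨ cong (_+ L₂) (sym T[y₀+1]≡) ⟩
      T (suc y₀) + L₂          ≡⟨ sym (T-+ (suc y₀) (m + j)) ⟩
      T (suc y₀ + (m + j))     ∎)) (InBlock-T _)
      where open ≡-Reasoning
    bs : ℕ
    bs = proj₁ (block (T x + n))
    Tx+n∈bs : InBlock bs (T x + n)
    Tx+n∈bs = proj₂ (block (T x + n))
    bs<x+m : bs < x + m
    bs<x+m = T-cancel-< (≤-<-trans (lower Tx+n∈bs) (begin-strict
      T x + n
        <⟨ +-monoʳ-< (T x) (lift-inside m j k n v A₁ A₂ k+n≡ gap cond) ⟩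
      T x + (m * suc q + g * A₁)
        ≡⟨ sym (T-+ x m) ⟩
      T (x + m) ∎))
      where open ≤-Reasoning

  unbalance-A-B : Unbalance 0 1
  unbalance-A-B = unbalance 0 (ℓ (u 0)) 1 (1≤ℓ (u 0)) (≤-reflexive (begin
    isA (u (ℓ (u 0))) + 0 + 1   ≡⟨ cong (λ l → isA l + 0 + 1) (u-T-B 0) ⟩
    1                           ≡⟨ cong (λ l → isA l + 0) (sym (u-T-A 0 (1≤ℓ (u 0)))) ⟩
    isA (u 0) + 0               ∎))
    where open ≡-Reasoning

  unbalance-longer : ∀ t → t * q ≤ g → Unbalance t 1
  unbalance-longer zero    _      = unbalance-A-B
  unbalance-longer (suc t) q+tq≤g =
    lift (unbalance-longer t (≤-trans (m≤n+m (t * q) q) q+tq≤g)) ≤-refl cond (+-comm 2 t)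
    where
    cond : t * suc q + 2 ≤ g * 1 + suc t
    cond = begin
      t * suc q + 2          ≡⟨ solve (t ∷ q ∷ []) ⟩
      1 + t * q + suc t      ≤⟨ +-monoˡ-≤ (suc t) (≤-trans (+-monoˡ-≤ (t * q) 1≤q) q+tq≤g) ⟩
      g + suc t              ≡⟨ cong (_+ suc t) (sym (*-identityʳ g)) ⟩
      g * 1 + suc t          ∎
      where open ≤-Reasoning

  unbalance-equal-length : ∀ s → s * q + 2 ≤ g → Unbalance 0 (s + 2)
  unbalance-equal-length s sq+2≤g =
    lift (lift (unbalance-longer s sq≤g) (n≤1+n s) cond₁ (+-comm 2 s))
         z≤n cond₂ (+-identityʳ (s + 2))
    where
    open ≤-Reasoning
    sq≤g : s * q ≤ g
    sq≤g = ≤-trans (m≤m+n (s * q) 2) sq+2≤g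
    s≤g : s ≤ g
    s≤g = ≤-trans (≤-trans (≤-reflexive (sym (*-identityʳ s))) (*-monoʳ-≤ s 1≤q)) sq≤g
    cond₁ : s * suc q + 2 ≤ g * 1 + s
    cond₁ = begin
      s * suc q + 2     ≡⟨ solve (s ∷ q ∷ []) ⟩
      s * q + 2 + s     ≤⟨ +-monoˡ-≤ s sq+2≤g ⟩
      g + s             ≡⟨ cong (_+ s) (sym (*-identityʳ g)) ⟩
      g * 1 + s         ∎
    cond₂ : s * suc q + 2 ≤ g * 2 + 0
    cond₂ = begin
      s * suc q + 2     ≡⟨ solve (s ∷ q ∷ []) ⟩
      s * q + 2 + s     ≤⟨ +-mono-≤ sq+2≤g s≤g ⟩
      g + g             ≡⟨ solve (g ∷ []) ⟩
      g * 2 + 0         ∎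

  unbalanced : ∀ {v} → Unbalance 0 v → ∀ c′ → c′ < v → ¬ Balanced u c′
  unbalanced {v} (unbalance x y m _ gap) c′ c′<v balanced = <⇒≱ c′<v (begin
    v                                  ≤⟨ m+n≤o⇒m≤o∸n v v+count-y≤count-x ⟩
    countA u x m ∸ countA u y m        ≤⟨ m∸n≤∣m-n∣ (countA u x m) (countA u y m) ⟩
    ∣ countA u x m - countA u y m ∣    ≤⟨ balanced x y m ⟩
    c′                                 ∎)
    where
    open ≤-Reasoning
    v+count-y≤count-x : v + countA u y m ≤ countA u x m
    v+count-y≤count-x = subst (_≤ countA u x m)
      (trans (cong (λ l → countA u y l + v) (+-identityʳ m)) (+-comm (countA u y m) v)) gap

  uβ-unbalanced : ∀ c₁ → c₁ * q + 2 ≤ p → ∀ c′ → c′ < suc c₁ → ¬ Balanced u c′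
  uβ-unbalanced zero    _          = unbalanced unbalance-A-B
  uβ-unbalanced (suc s) [s+1]q+2≤p c′ c′<s+2 =
    unbalanced (unbalance-equal-length s sq+2≤g) c′ (subst (c′ <_) (+-comm 2 s) c′<s+2)
    where
    sq+2≤g : s * q + 2 ≤ g
    sq+2≤g = +-cancelˡ-≤ q _ _ (≤-trans (≤-reflexive (sym (+-assoc q (s * q) 2))) [s+1]q+2≤p)

ceilDiv-spec : ∀ a q₀ →
               a ≤ ceilDiv a (suc q₀) * suc q₀ × ceilDiv a (suc q₀) * suc q₀ ≤ a + q₀
ceilDiv-spec a q₀ = a≤cq , cq≤a+q₀
  where
  open ≤-Reasoning
  c r : ℕ
  c = ceilDiv a (suc q₀)
  r = (a + q₀) % suc q₀
  division : a + q₀ ≡ r + c * suc q₀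
  division = m≡m%n+[m/n]*n (a + q₀) (suc q₀)
  a≤cq : a ≤ c * suc q₀
  a≤cq = +-cancelʳ-≤ q₀ _ _ (begin
    a + q₀              ≡⟨ division ⟩
    r + c * suc q₀      ≤⟨ +-monoˡ-≤ (c * suc q₀) (s≤s⁻¹ (m%n<n (a + q₀) (suc q₀))) ⟩
    q₀ + c * suc q₀     ≡⟨ +-comm q₀ _ ⟩
    c * suc q₀ + q₀     ∎)
  cq≤a+q₀ : c * suc q₀ ≤ a + q₀
  cq≤a+q₀ = begin
    c * suc q₀          ≤⟨ m≤n+m _ r ⟩
    r + c * suc q₀      ≡⟨ sym division ⟩
    a + q₀              ∎

ceilDiv-bounds : ∀ {p q} → 1 ≤ q → q < p →
                 ∃[ c₁ ] ceilDiv (p ∸ 1) q ≡ suc c₁ × p ≤ suc c₁ * q + 1 × c₁ * q + 2 ≤ p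
ceilDiv-bounds {suc a} {suc q₀} _ (s≤s q₀<a) = bounds (ceilDiv a (suc q₀)) (ceilDiv-spec a q₀)
  where
  bounds : ∀ c → a ≤ c * suc q₀ × c * suc q₀ ≤ a + q₀ →
           ∃[ c₁ ] c ≡ suc c₁ × suc a ≤ suc c₁ * suc q₀ + 1 × c₁ * suc q₀ + 2 ≤ suc a
  bounds zero     (a≤0 , _)        = contradiction (≤-trans q₀<a a≤0) λ ()
  bounds (suc c₁) (a≤cq , cq≤a+q₀) =
    c₁ , refl , ≤-trans (s≤s a≤cq) (≤-reflexive (+-comm 1 _)) , +-cancelʳ-≤ q₀ _ _ (begin
      c₁ * suc q₀ + 2 + q₀              ≡⟨ solve (c₁ ∷ q₀ ∷ []) ⟩
      suc (suc q₀ + c₁ * suc q₀)        ≤⟨ s≤s cq≤a+q₀ ⟩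
      suc a + q₀                        ∎)
    where open ≤-Reasoning

mainTheorem3 : (p q : ℕ) → 1 ≤ q → q < p →
    Balanced (uβ p q) (ceilDiv (p ∸ 1) q)
    × (∀ (c′ : ℕ) → c′ < ceilDiv (p ∸ 1) q → ¬ Balanced (uβ p q) c′)
mainTheorem3 p q 1≤q q<p
  with c₁ , ⌈p-1/q⌉≡ , p≤[c₁+1]q+1 , c₁q+2≤p ← ceilDiv-bounds 1≤q q<p
  with g , refl ← m≤n⇒∃[o]m+o≡n (<⇒≤ q<p)
  rewrite ⌈p-1/q⌉≡ =
    FixedPoint.uβ-balanced q g 1≤q c₁ p≤[c₁+1]q+1 ,
    FixedPoint.uβ-unbalanced q g 1≤q c₁ c₁q+2≤p
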